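{- Consider the secretary problem on $n$ items where the order of arrival (and the values) is chosen by an adversary. For every (possibly randomized) online algorithm that satisfies the expected capacity constraint of $1$, its competitive ratio is at most $1/n$: there is an input sequence on which the probability that the algorithm selects the item of largest value is at most $1/n$.
   Context: There are $n$ items, each of weight $1$, with real values; an adversary chooses the input sequence (values and order of arrival). On each arrival an online algorithm must irrevocably decide whether to select the item, based on the values seen so far and its internal randomness; selected items cannot be removed and the algorithm may continue selecting. The expected capacity constraint of $1$ requires that on every input sequence the expected number of selected items (over the algorithm's randomness) is at most $1$. The competitive ratio is the minimum over input sequences of the probability that the algorithm selects the item of largest value.
   Formalization: The online algorithms select each arriving item with a rational probability depending on the values seen and their own past decisions, and the item values are taken in the rationals. -}

module Defs where

open import Data.Nat using (ℕ; zero; suc)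
open import Data.Bool using (Bool; true; false)
open import Data.List using (List; []; _∷_; concatMap)
open import Data.Vec using (Vec; []; _∷_)
open import Data.Product using (_×_; _,_)
open import Data.Rational using (ℚ; 0ℚ; 1ℚ; _+_; _*_; _-_; _≤_)

-- A s ds is the probability of selecting the current item, where
--   s  = values seen so far, most recent (= current item) first,
--   ds = the algorithm's own past decisions, most recent first.
Alg : Set
Alg = List ℚ → List Bool → ℚ

ValidAlg : Alg → Set
ValidAlg A = ∀ s ds → (0ℚ ≤ A s ds) × (A s ds ≤ 1ℚ)

-- Finite distribution over decision histories: list of (history, probability).
Dist : Set
Dist = List (List Bool × ℚ)

sumℚ : List ℚ → ℚ
sumℚ [] = 0ℚ
sumℚ (x ∷ xs) = x + sumℚ xs

sumVℚ : ∀ {k} → Vec ℚ k → ℚ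
sumVℚ [] = 0ℚ
sumVℚ (x ∷ xs) = x + sumVℚ xs

selNow : Alg → List ℚ → Dist → ℚ
selNow A s [] = 0ℚ
selNow A s ((ds , q) ∷ d) = q * A s ds + selNow A s d

branch : Alg → List ℚ → Dist → Dist
branch A s = concatMap (λ { (ds , q) →
  (true ∷ ds , q * A s ds) ∷ (false ∷ ds , q * (1ℚ - A s ds)) ∷ [] })

go : ∀ {k} → Alg → List ℚ → Dist → Vec ℚ k → Vec ℚ k
go A seen d [] = []
go A seen d (v ∷ rest) =
  selNow A (v ∷ seen) d ∷ go A (v ∷ seen) (branch A (v ∷ seen) d) rest

-- selProbs A xs : the i-th entry is the probability that A selects item i
-- when the input sequence (in arrival order) is xs.
selProbs : ∀ {k} → Alg → Vec ℚ k → Vec ℚ k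
selProbs A xs = go A [] (([] , 1ℚ) ∷ []) xs

expectedCount : ∀ {k} → Alg → Vec ℚ k → ℚ
expectedCount A xs = sumVℚ (selProbs A xs)

ExpCap1 : ℕ → Alg → Set
ExpCap1 n A = (xs : Vec ℚ n) → expectedCount A xs ≤ 1ℚ

{-# OPTIONS --safe #-}
-- Feed the algorithm the increasing sequence 0, 1, …, n − 1.  Its selection
-- probabilities sum to at most 1, so some position i is selected with
-- probability at most 1/n.  Now replace every value after position i by a
-- distinct negative number: item i becomes the largest one, and since the
-- decision on item i depends only on the items up to i, it is still selected
-- with probability at most 1/n.
module Submission where

open import Defs
open import Data.Nat using (ℕ; NonZero)
open import Data.Fin using (Fin)
open import Data.Vec using (Vec; lookup)
open import Data.Product using (Σ; _×_)
open import Data.Integer using (+_)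
open import Data.Rational using (ℚ; _≤_; _/_)
open import Relation.Binary.PropositionalEquality using (_≡_)

open import Data.Empty using (⊥-elim)
open import Data.Fin using (zero; suc; toℕ)
open import Data.Fin.Properties using (toℕ-injective; any?)
open import Data.Integer using (ℤ; -[1+_]; +≤+; -≤+)
open import Data.List using (List; []; _∷_)
open import Data.Nat using (suc; z≤n; s≤s)
open import Data.Nat.Coprimality using (1-coprimeTo) renaming (sym to coprime-sym)
open import Data.Product using (∃; _,_)
open import Data.Rational using (mkℚ; 1ℚ; _+_; _*_; _<_; 1/_; *≤*)
open import Data.Rational.Properties
  using (≤-refl; _≤?_; ≰⇒>; <-irrefl; <-≤-trans; +-mono-<; +-mono-<-≤;
         *-zeroˡ; *-identityˡ; *-distribʳ-+; *-inverseʳ; normalize-coprime)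
open import Data.Vec using (_∷_; []; replicate; tabulate)
open import Data.Vec.Properties using (lookup∘tabulate; lookup-replicate)
open import Function using (_∘_)
open import Relation.Binary.PropositionalEquality using (refl; sym; cong; subst; module ≡-Reasoning)
open import Relation.Nullary using (yes; no)

import Data.Fin as Fin
import Data.Integer as ℤ
import Data.Integer.Properties as ℤ
import Data.Nat as ℕ
import Data.Nat.Properties as ℕ

open ≡-Reasoning

fromℤ : ℤ → ℚ
fromℤ z = mkℚ z 0 (coprime-sym (1-coprimeTo ℤ.∣ z ∣))

fromℤ-injective : ∀ {a b} → fromℤ a ≡ fromℤ b → a ≡ b
fromℤ-injective = cong ℚ.numerator

fromℤ-mono-≤ : ∀ {a b} → a ℤ.≤ b → fromℤ a ≤ fromℤ b
fromℤ-mono-≤ a≤b = *≤* (ℤ.*-monoʳ-≤-nonNeg (+ 1) a≤b)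

fromℤ-suc : ∀ m → fromℤ (+ suc m) ≡ 1ℚ + fromℤ (+ m)
fromℤ-suc m = sym (begin
  1ℚ + fromℤ (+ m)              ≡⟨⟩
  (+ 1 ℤ.+ + m ℤ.* + 1) / 1     ≡⟨ cong (λ z → (+ 1 ℤ.+ z) / 1) (ℤ.*-identityʳ (+ m)) ⟩
  + suc m / 1                   ≡⟨ normalize-coprime (coprime-sym (1-coprimeTo (suc m))) ⟩
  fromℤ (+ suc m)               ∎)

sumVℚ-replicate : ∀ m q → sumVℚ (replicate m q) ≡ fromℤ (+ m) * q
sumVℚ-replicate ℕ.zero q = sym (*-zeroˡ q)
sumVℚ-replicate (suc m) q = begin
  q + sumVℚ (replicate m q)         ≡⟨ cong (λ s → q + s) (sumVℚ-replicate m q) ⟩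
  q + fromℤ (+ m) * q               ≡⟨ cong (_+ fromℤ (+ m) * q) (sym (*-identityˡ q)) ⟩
  1ℚ * q + fromℤ (+ m) * q          ≡⟨ sym (*-distribʳ-+ q 1ℚ (fromℤ (+ m))) ⟩
  (1ℚ + fromℤ (+ m)) * q            ≡⟨ cong (_* q) (sym (fromℤ-suc m)) ⟩
  fromℤ (+ suc m) * q               ∎

sumVℚ-replicate-1/n : ∀ n .{{_ : NonZero n}} → sumVℚ (replicate n ((+ 1) / n)) ≡ 1ℚ
sumVℚ-replicate-1/n n@(suc _) = begin
  sumVℚ (replicate n ((+ 1) / n))   ≡⟨ sumVℚ-replicate n ((+ 1) / n) ⟩
  fromℤ (+ n) * ((+ 1) / n)         ≡⟨ cong (fromℤ (+ n) *_) (normalize-coprime (1-coprimeTo n)) ⟩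
  fromℤ (+ n) * 1/ fromℤ (+ n)      ≡⟨ *-inverseʳ (fromℤ (+ n)) ⟩
  1ℚ                                ∎

sumVℚ-mono-< : ∀ {k} (u v : Vec ℚ (suc k)) → (∀ i → lookup u i < lookup v i) → sumVℚ u < sumVℚ v
sumVℚ-mono-< (_ ∷ []) (_ ∷ []) u<v = +-mono-<-≤ (u<v zero) ≤-refl
sumVℚ-mono-< (_ ∷ u@(_ ∷ _)) (_ ∷ v) u<v = +-mono-< (u<v zero) (sumVℚ-mono-< u v (u<v ∘ suc))

∃-lookup-≤-1/n : ∀ n .{{_ : NonZero n}} (v : Vec ℚ n) → sumVℚ v ≤ 1ℚ → ∃ λ i → lookup v i ≤ (+ 1) / n
∃-lookup-≤-1/n n@(suc _) v Σv≤1 with any? (λ i → lookup v i ≤? (+ 1) / n)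
... | yes found = found
... | no none = ⊥-elim (<-irrefl refl (<-≤-trans 1<Σv Σv≤1))
  where
  1<Σv : 1ℚ < sumVℚ v
  1<Σv = subst (_< sumVℚ v) (sumVℚ-replicate-1/n n)
    (sumVℚ-mono-< (replicate n _) v λ i →
      subst (_< lookup v i) (sym (lookup-replicate i _)) (≰⇒> (none ∘ (i ,_))))

go-cong-prefix : ∀ {k} (A : Alg) (seen : List ℚ) (d : Dist) (xs ys : Vec ℚ k) (i : Fin k) →
                 (∀ j → j Fin.≤ i → lookup xs j ≡ lookup ys j) →
                 lookup (go A seen d xs) i ≡ lookup (go A seen d ys) i
go-cong-prefix A seen d (x ∷ xs) (_ ∷ ys) i agree with agree zero z≤n
go-cong-prefix A seen d (x ∷ xs) (_ ∷ ys) zero    agree | refl = refl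
go-cong-prefix A seen d (x ∷ xs) (_ ∷ ys) (suc i) agree | refl =
  go-cong-prefix A (x ∷ seen) (branch A (x ∷ seen) d) xs ys i (λ j j≤i → agree (suc j) (s≤s j≤i))

selProbs-cong-prefix : ∀ {k} (A : Alg) (xs ys : Vec ℚ k) (i : Fin k) →
                       (∀ j → j Fin.≤ i → lookup xs j ≡ lookup ys j) →
                       lookup (selProbs A xs) i ≡ lookup (selProbs A ys) i
selProbs-cong-prefix A = go-cong-prefix A [] (([] , 1ℚ) ∷ [])

peak : ℕ → ℕ → ℤ
peak i j with j ℕ.≤? i
... | yes _ = + j
... | no  _ = -[1+ j ]

peak-≤ : ∀ {i j} → j ℕ.≤ i → peak i j ≡ + j
peak-≤ {i} {j} j≤i with j ℕ.≤? i
... | yes _   = refl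
... | no  j≰i = ⊥-elim (j≰i j≤i)

peak-injective : ∀ i {j j′} → peak i j ≡ peak i j′ → j ≡ j′
peak-injective i {j} {j′} eq with j ℕ.≤? i | j′ ℕ.≤? i | eq
... | yes _ | yes _ | refl = refl
... | no  _ | no  _ | refl = refl

peak-maximum : ∀ i j → peak i j ℤ.≤ + i
peak-maximum i j with j ℕ.≤? i
... | yes j≤i = +≤+ j≤i
... | no  _   = -≤+

ascending : (n : ℕ) → Vec ℚ n
ascending n = tabulate (fromℤ ∘ +_ ∘ toℕ)

peakedAt : ∀ {n} → Fin n → Vec ℚ n
peakedAt i = tabulate (fromℤ ∘ peak (toℕ i) ∘ toℕ)

peakedAt-prefix : ∀ {n} (i j : Fin n) → j Fin.≤ i → lookup (peakedAt i) j ≡ lookup (ascending n) j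
peakedAt-prefix {n} i j j≤i = begin
  lookup (peakedAt i) j         ≡⟨ lookup∘tabulate _ j ⟩
  fromℤ (peak (toℕ i) (toℕ j))  ≡⟨ cong fromℤ (peak-≤ j≤i) ⟩
  fromℤ (+ toℕ j)               ≡⟨ lookup∘tabulate _ j ⟨
  lookup (ascending n) j        ∎

peakedAt-injective : ∀ {n} (i j j′ : Fin n) → lookup (peakedAt i) j ≡ lookup (peakedAt i) j′ → j ≡ j′
peakedAt-injective i j j′ eq = toℕ-injective (peak-injective (toℕ i) (fromℤ-injective (begin
  fromℤ (peak (toℕ i) (toℕ j))   ≡⟨ lookup∘tabulate _ j ⟨
  lookup (peakedAt i) j          ≡⟨ eq ⟩
  lookup (peakedAt i) j′         ≡⟨ lookup∘tabulate _ j′ ⟩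
  fromℤ (peak (toℕ i) (toℕ j′))  ∎)))

peakedAt-maximum : ∀ {n} (i j : Fin n) → lookup (peakedAt i) j ≤ lookup (peakedAt i) i
peakedAt-maximum i j rewrite lookup∘tabulate (fromℤ ∘ peak (toℕ i) ∘ toℕ) j
                           | lookup∘tabulate (fromℤ ∘ peak (toℕ i) ∘ toℕ) i
                           | peak-≤ (ℕ.≤-refl {toℕ i})
  = fromℤ-mono-≤ (peak-maximum (toℕ i) (toℕ j))

theorem1 : (n : ℕ) → .{{_ : NonZero n}} → (A : Alg) → ValidAlg A → ExpCap1 n A →
    Σ (Vec ℚ n) λ xs →
      ((i j : Fin n) → lookup xs i ≡ lookup xs j → i ≡ j) ×
      Σ (Fin n) λ i →
        ((j : Fin n) → lookup xs j ≤ lookup xs i) ×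
        (lookup (selProbs A xs) i ≤ (+ 1) / n)
theorem1 n A _ cap with ∃-lookup-≤-1/n n (selProbs A (ascending n)) (cap (ascending n))
... | i , pᵢ≤1/n = peakedAt i , peakedAt-injective i , i , peakedAt-maximum i ,
  subst (_≤ (+ 1) / n) (sym (selProbs-cong-prefix A (peakedAt i) (ascending n) i (peakedAt-prefix i))) pᵢ≤1/n
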